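{- Let $T$ be a tree with maximum degree $\Delta(T)\ge 3$. Then $\tau'_2(T)=2\Delta(T)$.
   Context: All graphs are simple and finite. For edges $e,e'$ of a graph $G$, the distance $d_G(e,e')$ is the distance between the corresponding vertices in the line graph $L(G)$ (so adjacent edges are at distance $1$). For integers $1\le t\le k$, a $t$-tone edge $k$-coloring of $G$ is a map $f:E(G)\to\binom{\{1,\dots,k\}}{t}$ (assigning to each edge a $t$-element subset of $\{1,\dots,k\}$) such that for any two distinct edges $e,e'$, $|f(e)\cap f(e')|<d_G(e,e')$. The $t$-tone chromatic index $\tau'_t(G)$ is the minimum $k$ such that $G$ admits a $t$-tone edge $k$-coloring. For $t=2$: adjacent edges get disjoint labels and edges at distance two get distinct labels. -}

module Defs where

open import Data.Nat using (ℕ; zero; suc; _≤_; _<_; _⊔_)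
open import Data.Bool using (Bool; true; false)
open import Data.Fin using (Fin; zero; suc; inject₁; fromℕ) renaming (_<_ to _<ᶠ_)
open import Data.Fin.Subset using (Subset; ∣_∣; _∩_)
open import Data.Vec using (tabulate)
open import Data.List using (List; foldr; map; allFin)
open import Data.Product using (Σ; ∃; _×_; _,_; proj₁; proj₂)
open import Data.Sum using (_⊎_)
open import Function.Definitions using (Injective)
open import Relation.Binary.PropositionalEquality using (_≡_; _≢_)
open import Relation.Nullary using (¬_)

record Graph (n : ℕ) : Set where
  field
    adj    : Fin n → Fin n → Bool
    sym    : ∀ u v → adj u v ≡ adj v u
    irrefl : ∀ v → adj v v ≡ false
open Graph public

data Reach {n : ℕ} (G : Graph n) : Fin n → Fin n → Set where
  here : ∀ {v} → Reach G v v
  step : ∀ {u w v} → adj G u w ≡ true → Reach G w v → Reach G u v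

Connected : ∀ {n} → Graph n → Set
Connected G = ∀ u v → Reach G u v

record Cycle {n : ℕ} (G : Graph n) : Set where
  field
    m    : ℕ
    c    : Fin (suc (suc (suc m))) → Fin n
    inj  : Injective _≡_ _≡_ c
    adjs : ∀ (i : Fin (suc (suc m))) → adj G (c (inject₁ i)) (c (suc i)) ≡ true
    close : adj G (c (fromℕ (suc (suc m)))) (c zero) ≡ true

Acyclic : ∀ {n} → Graph n → Set
Acyclic G = ¬ Cycle G

IsTree : ∀ {n} → Graph n → Set
IsTree G = Connected G × Acyclic G

degree : ∀ {n} → Graph n → Fin n → ℕ
degree G v = ∣ tabulate (adj G v) ∣

maxDegree : ∀ {n} → Graph n → ℕ
maxDegree {n} G = foldr _⊔_ 0 (map (degree G) (allFin n))

-- Edges: ordered representatives u < v of the unordered pair {u,v}.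
Edge : ∀ {n} → Graph n → Set
Edge {n} G = Σ (Fin n × Fin n) λ p → (proj₁ p <ᶠ proj₂ p) × (adj G (proj₁ p) (proj₂ p) ≡ true)

endpt₁ endpt₂ : ∀ {n} {G : Graph n} → Edge G → Fin n
endpt₁ e = proj₁ (proj₁ e)
endpt₂ e = proj₂ (proj₁ e)

LAdj : ∀ {n} (G : Graph n) → Edge G → Edge G → Set
LAdj G e e' = e ≢ e' × ((endpt₁ {G = G} e ≡ endpt₁ {G = G} e') ⊎ (endpt₁ {G = G} e ≡ endpt₂ {G = G} e')
                        ⊎ (endpt₂ {G = G} e ≡ endpt₁ {G = G} e') ⊎ (endpt₂ {G = G} e ≡ endpt₂ {G = G} e'))

data LWalk {n : ℕ} (G : Graph n) : Edge G → Edge G → ℕ → Set where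
  here : ∀ {e} → LWalk G e e 0
  step : ∀ {e e'' e' k} → LAdj G e e'' → LWalk G e'' e' k → LWalk G e e' (suc k)

-- d_G(e,e') ≤ k  (distance in the line graph; ∞ if no walk).
DistLE : ∀ {n} (G : Graph n) → Edge G → Edge G → ℕ → Set
DistLE G e e' k = ∃ λ j → j ≤ k × LWalk G e e' j

-- t-tone edge k-coloring: each edge gets a t-subset of a k-element colour set
-- (Fin k ≅ {1,…,k}), and |f e ∩ f e'| < d(e,e') for distinct e, e',
-- i.e. NOT d(e,e') ≤ |f e ∩ f e'|.
ToneEdgeColoring : ∀ {n} (t k : ℕ) (G : Graph n) → Set
ToneEdgeColoring t k G =
  Σ (Edge G → Subset k) λ f →
    (∀ e → ∣ f e ∣ ≡ t) ×
    (∀ e e' → e ≢ e' → ¬ DistLE G e e' ∣ f e ∩ f e' ∣)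

ToneChromaticIndexIs : ∀ {n} (t : ℕ) (G : Graph n) (k : ℕ) → Set
ToneChromaticIndexIs t G k =
  ToneEdgeColoring t k G × (∀ j → j < k → ¬ ToneEdgeColoring t j G)

-- Root the tree and give every vertex v a palette: a bijection from positions
-- (slot j, side 0/1), j < Δ, onto the 2Δ colours.  The edge from v to its neighbour in
-- slot j receives the two colours of slot j, and slot 0 holds the edge to the parent.
-- A child's palette is its parent's palette precomposed with a permutation that moves
-- slot 0 onto the child's slot and sends the two positions of every other slot to
-- different slots (possible as soon as there are two nonzero slots, i.e. Δ ≥ 3).
-- Adjacent edges then occupy different slots of one palette, hence get disjoint colour
-- pairs; for edges at distance two, read in the palette of the upper end of the middle
-- edge, one fills a slot and the other is split over two slots, so they share at most
-- one colour.  Conversely, the Δ edges at a vertex of maximum degree need pairwise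
-- disjoint pairs.
module Submission where

open import Defs renaming (sym to adj-sym; irrefl to adj-irrefl)

open import Axiom.UniquenessOfIdentityProofs using (module Decidable⇒UIP)
open import Data.Bool using (Bool; true)
import Data.Bool as Bool
open import Data.Empty using (⊥; ⊥-elim)
open import Data.Fin using (Fin; zero; suc; toℕ; fromℕ; inject₁; inject≤; combine)
open import Data.Fin.Patterns using (0F; 1F)
open import Data.Fin.Permutation.Components using (transpose; transpose-inverse)
open import Data.Fin.Properties
  using (_≟_; <-cmp; any?; fromℕ≢inject₁; inject₁-injective; toℕ-inject₁;
         inject≤-injective; combine-injective)
import Data.Fin.Properties as Fin
open import Data.Fin.Subset
  using (Subset; ∣_∣; _∩_; _∪_; ⁅_⁆; _∈_; _∉_; _⊆_; Empty; inside; outside)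
  renaming (⊥ to ∅)
open import Data.Fin.Subset.Properties
  using (∉⊥; _∈?_; x∈⁅x⁆; x∈⁅y⁆⇒x≡y; x∈p∪q⁻; x∈p∩q⁺; x∈p∩q⁻; ∣⁅x⁆∣≡1; ∣⊥∣≡0;
         Empty-unique; p⊆q⇒∣p∣≤∣q∣; ∣p∣≤n; ∣p∩q∣≤∣p∣; ∩-comm; ∪-comm)
open import Data.List using (List; []; _∷_; length; _++_; [_]; lookup; foldr; map; allFin)
open import Data.List.Membership.Propositional using () renaming (_∈_ to _∈ₗ_)
open import Data.List.Membership.Propositional.Properties using (∈-lookup; ∈-allFin)
open import Data.List.Relation.Unary.All as All using (All; []; _∷_)
import Data.List.Relation.Unary.All.Properties as All
open import Data.List.Relation.Unary.AllPairs using ([]; _∷_)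
import Data.List.Relation.Unary.AllPairs.Properties as AllPairs
open import Data.List.Relation.Unary.Any using (here; there)
open import Data.List.Relation.Unary.Linked using (Linked; _∷_; [-])
open import Data.List.Relation.Unary.Unique.Propositional using (Unique)
open import Data.Nat using (ℕ; zero; suc; _+_; _*_; _≤_; _<_; _⊔_; z≤n; s≤s)
open import Data.Nat.Properties
  using (module ≤-Reasoning; suc-injective; +-suc; +-identityʳ; *-suc; *-zeroʳ; 1+n≢n;
         ≤-reflexive; ≤-trans; ≤-antisym; <-irrefl; <-asym; <-trans; ≤-<-trans; <-irrelevant;
         <⇒≱; ≰⇒>; n<1+n; m<n⇒m<1+n; m≤n⇒m≤1+n; m≤m⊔n; m≤n⊔m; ⊔-sel)
  renaming (<-cmp to <-cmpℕ)
open import Data.Product using (Σ; ∃; ∃₂; _×_; _,_; proj₁; proj₂; map₁; map₂)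
open import Data.Sum using (_⊎_; inj₁; inj₂)
open import Data.Vec using ([]; _∷_; here; there; tabulate)
open import Data.Vec.Properties using (lookup∘tabulate; []=⇒lookup; lookup⇒[]=)
open import Function using (_∘_)
open import Function.Definitions using (Injective)
open import Relation.Binary using (Rel; tri<; tri≈; tri>)
open import Relation.Binary.PropositionalEquality
  using (_≡_; _≢_; refl; sym; trans; cong; cong₂; subst; subst₂; module ≡-Reasoning)
open import Relation.Nullary using (¬_; Dec; contradiction; yes; no)
open import Relation.Nullary.Decidable using (dec-true; _⊎-dec_; _×-dec_)

variable
  m n : ℕ

pair : Fin m → Fin m → Subset m
pair a b = ⁅ a ⁆ ∪ ⁅ b ⁆

x∈pair⁻ : ∀ {x a b : Fin m} → x ∈ pair a b → x ≡ a ⊎ x ≡ b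
x∈pair⁻ {a = a} {b} x∈ with x∈p∪q⁻ ⁅ a ⁆ ⁅ b ⁆ x∈
... | inj₁ x∈a = inj₁ (x∈⁅y⁆⇒x≡y a x∈a)
... | inj₂ x∈b = inj₂ (x∈⁅y⁆⇒x≡y b x∈b)

∣p∪q∣+∣p∩q∣≡∣p∣+∣q∣ : (p q : Subset m) → ∣ p ∪ q ∣ + ∣ p ∩ q ∣ ≡ ∣ p ∣ + ∣ q ∣
∣p∪q∣+∣p∩q∣≡∣p∣+∣q∣ [] [] = refl
∣p∪q∣+∣p∩q∣≡∣p∣+∣q∣ (outside ∷ p) (outside ∷ q) = ∣p∪q∣+∣p∩q∣≡∣p∣+∣q∣ p q
∣p∪q∣+∣p∩q∣≡∣p∣+∣q∣ (inside ∷ p) (outside ∷ q) = cong suc (∣p∪q∣+∣p∩q∣≡∣p∣+∣q∣ p q)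
∣p∪q∣+∣p∩q∣≡∣p∣+∣q∣ (outside ∷ p) (inside ∷ q) =
  trans (cong suc (∣p∪q∣+∣p∩q∣≡∣p∣+∣q∣ p q)) (sym (+-suc ∣ p ∣ ∣ q ∣))
∣p∪q∣+∣p∩q∣≡∣p∣+∣q∣ (inside ∷ p) (inside ∷ q) =
  trans (cong suc (trans (+-suc ∣ p ∪ q ∣ ∣ p ∩ q ∣) (cong suc (∣p∪q∣+∣p∩q∣≡∣p∣+∣q∣ p q))))
        (cong suc (sym (+-suc ∣ p ∣ ∣ q ∣)))

Empty⇒∣p∣≡0 : {p : Subset m} → Empty p → ∣ p ∣ ≡ 0
Empty⇒∣p∣≡0 {m} empty = trans (cong ∣_∣ (Empty-unique empty)) (∣⊥∣≡0 m)

x∈p⇒0<∣p∣ : ∀ {p : Subset m} {x} → x ∈ p → 0 < ∣ p ∣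
x∈p⇒0<∣p∣ {x = x} x∈p = ≤-trans (≤-reflexive (sym (∣⁅x⁆∣≡1 x)))
  (p⊆q⇒∣p∣≤∣q∣ (λ y∈⁅x⁆ → subst (_∈ _) (sym (x∈⁅y⁆⇒x≡y x y∈⁅x⁆)) x∈p))

∣p∪q∣≡∣p∣+∣q∣ : (p q : Subset m) → Empty (p ∩ q) → ∣ p ∪ q ∣ ≡ ∣ p ∣ + ∣ q ∣
∣p∪q∣≡∣p∣+∣q∣ p q empty = begin
  ∣ p ∪ q ∣                ≡⟨ sym (+-identityʳ _) ⟩
  ∣ p ∪ q ∣ + 0            ≡⟨ cong (∣ p ∪ q ∣ +_) (sym (Empty⇒∣p∣≡0 empty)) ⟩
  ∣ p ∪ q ∣ + ∣ p ∩ q ∣    ≡⟨ ∣p∪q∣+∣p∩q∣≡∣p∣+∣q∣ p q ⟩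
  ∣ p ∣ + ∣ q ∣            ∎
  where open ≡-Reasoning

∣pair∣≡2 : {a b : Fin m} → a ≢ b → ∣ pair a b ∣ ≡ 2
∣pair∣≡2 {a = a} {b} a≢b = begin
  ∣ ⁅ a ⁆ ∪ ⁅ b ⁆ ∣      ≡⟨ ∣p∪q∣≡∣p∣+∣q∣ ⁅ a ⁆ ⁅ b ⁆ disjoint ⟩
  ∣ ⁅ a ⁆ ∣ + ∣ ⁅ b ⁆ ∣  ≡⟨ cong₂ _+_ (∣⁅x⁆∣≡1 a) (∣⁅x⁆∣≡1 b) ⟩
  2                      ∎
  where
  open ≡-Reasoning
  disjoint : Empty (⁅ a ⁆ ∩ ⁅ b ⁆)
  disjoint (x , x∈a∩b) with x∈p∩q⁻ ⁅ a ⁆ ⁅ b ⁆ x∈a∩b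
  ... | x∈a , x∈b = a≢b (trans (sym (x∈⁅y⁆⇒x≡y a x∈a)) (x∈⁅y⁆⇒x≡y b x∈b))

∣pair∩q∣≤1 : {a b : Fin m} (q : Subset m) → a ∉ q ⊎ b ∉ q → ∣ pair a b ∩ q ∣ ≤ 1
∣pair∩q∣≤1 {a = a} {b} q (inj₁ a∉q) = ≤-trans (p⊆q⇒∣p∣≤∣q∣ ⊆⁅b⁆) (≤-reflexive (∣⁅x⁆∣≡1 b))
  where
  ⊆⁅b⁆ : pair a b ∩ q ⊆ ⁅ b ⁆
  ⊆⁅b⁆ x∈ with x∈p∩q⁻ (pair a b) q x∈
  ... | x∈ab , x∈q with x∈pair⁻ x∈ab
  ...   | inj₁ refl = contradiction x∈q a∉q
  ...   | inj₂ refl = x∈⁅x⁆ b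
∣pair∩q∣≤1 {a = a} {b} q (inj₂ b∉q) =
  subst (λ p → ∣ p ∩ q ∣ ≤ 1) (∪-comm ⁅ b ⁆ ⁅ a ⁆) (∣pair∩q∣≤1 q (inj₁ b∉q))

⋃∈ : (S : Subset n) → (∀ x → x ∈ S → Subset m) → Subset m
⋃∈ []           F = ∅
⋃∈ (inside ∷ S)  F = F zero here ∪ ⋃∈ S (λ x x∈S → F (suc x) (there x∈S))
⋃∈ (outside ∷ S) F = ⋃∈ S (λ x x∈S → F (suc x) (there x∈S))

∈⋃∈⁻ : (S : Subset n) (F : ∀ x → x ∈ S → Subset m) {y : Fin m} →
       y ∈ ⋃∈ S F → ∃₂ λ x (x∈S : x ∈ S) → y ∈ F x x∈S
∈⋃∈⁻ []            F y∈∅ = contradiction y∈∅ ∉⊥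
∈⋃∈⁻ (inside ∷ S)  F {y} y∈ with x∈p∪q⁻ (F zero here) _ y∈
... | inj₁ y∈F₀ = zero , here , y∈F₀
... | inj₂ y∈⋃ with ∈⋃∈⁻ S _ y∈⋃
...   | x , x∈S , y∈Fx = suc x , there x∈S , y∈Fx
∈⋃∈⁻ (outside ∷ S) F y∈ with ∈⋃∈⁻ S _ y∈
... | x , x∈S , y∈Fx = suc x , there x∈S , y∈Fx

∣⋃∈∣≡c*∣S∣ : ∀ {c} (S : Subset n) (F : ∀ x → x ∈ S → Subset m) →
             (∀ x x∈S → ∣ F x x∈S ∣ ≡ c) →
             (∀ x y x∈S y∈S → x ≢ y → Empty (F x x∈S ∩ F y y∈S)) →
             ∣ ⋃∈ S F ∣ ≡ c * ∣ S ∣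
∣⋃∈∣≡c*∣S∣ {m = m} {c = c} [] F size disjoint = trans (∣⊥∣≡0 m) (sym (*-zeroʳ c))
∣⋃∈∣≡c*∣S∣ {c = c} (inside ∷ S) F size disjoint = begin
  ∣ F zero here ∪ ⋃∈ S F′ ∣           ≡⟨ ∣p∪q∣≡∣p∣+∣q∣ _ _ F₀-disjoint ⟩
  ∣ F zero here ∣ + ∣ ⋃∈ S F′ ∣       ≡⟨ cong₂ _+_ (size zero here) (∣⋃∈∣≡c*∣S∣ S F′ (λ x _ → size (suc x) _)
                                          (λ x y _ _ x≢y → disjoint (suc x) (suc y) _ _ (x≢y ∘ Fin.suc-injective))) ⟩
  c + c * ∣ S ∣                       ≡⟨ sym (*-suc c ∣ S ∣) ⟩
  c * suc ∣ S ∣                       ∎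
  where
  open ≡-Reasoning
  F′ : ∀ x → x ∈ S → Subset _
  F′ x x∈S = F (suc x) (there x∈S)
  F₀-disjoint : Empty (F zero here ∩ ⋃∈ S F′)
  F₀-disjoint (y , y∈) with x∈p∩q⁻ (F zero here) _ y∈
  ... | y∈F₀ , y∈⋃ with ∈⋃∈⁻ S F′ y∈⋃
  ...   | x , x∈S , y∈Fx = disjoint zero (suc x) here (there x∈S) (λ ()) (y , x∈p∩q⁺ (y∈F₀ , y∈Fx))
∣⋃∈∣≡c*∣S∣ (outside ∷ S) F size disjoint =
  ∣⋃∈∣≡c*∣S∣ S _ (λ x _ → size (suc x) _)
    (λ x y _ _ x≢y → disjoint (suc x) (suc y) _ _ (x≢y ∘ Fin.suc-injective))

c*∣S∣≤m : ∀ {c} (S : Subset n) (F : ∀ x → x ∈ S → Subset m) →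
          (∀ x x∈S → ∣ F x x∈S ∣ ≡ c) →
          (∀ x y x∈S y∈S → x ≢ y → Empty (F x x∈S ∩ F y y∈S)) →
          c * ∣ S ∣ ≤ m
c*∣S∣≤m S F size disjoint = subst (_≤ _) (∣⋃∈∣≡c*∣S∣ S F size disjoint) (∣p∣≤n (⋃∈ S F))

∈-tabulate⁻ : ∀ {P : Fin n → Bool} {x} → x ∈ tabulate P → P x ≡ true
∈-tabulate⁻ {P = P} {x} x∈ = trans (sym (lookup∘tabulate P x)) ([]=⇒lookup x∈)

∈-tabulate⁺ : ∀ {P : Fin n → Bool} {x} → P x ≡ true → x ∈ tabulate P
∈-tabulate⁺ {P = P} {x} Px = lookup⇒[]= x (tabulate P) (trans (lookup∘tabulate P x) Px)

indexIn : ∀ {x : Fin n} (S : Subset n) → x ∈ S → Fin ∣ S ∣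
indexIn (inside ∷ S)  here        = zero
indexIn (inside ∷ S)  (there x∈S) = suc (indexIn S x∈S)
indexIn (outside ∷ S) (there x∈S) = indexIn S x∈S

indexIn-injective : ∀ {x y : Fin n} (S : Subset n) (x∈S : x ∈ S) (y∈S : y ∈ S) →
                    indexIn S x∈S ≡ indexIn S y∈S → x ≡ y
indexIn-injective (inside ∷ S)  here        here        _  = refl
indexIn-injective (inside ∷ S)  (there x∈S) (there y∈S) eq =
  cong suc (indexIn-injective S x∈S y∈S (Fin.suc-injective eq))
indexIn-injective (outside ∷ S) (there x∈S) (there y∈S) eq =
  cong suc (indexIn-injective S x∈S y∈S eq)

Position : ℕ → Set
Position d = Fin d × Fin 2

module _ {d : ℕ} {s : Position d → Fin m} (s-injective : Injective _≡_ _≡_ s) where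

  slotColours : Fin d → Subset m
  slotColours j = pair (s (j , 0F)) (s (j , 1F))

  ∣slotColours∣≡2 : ∀ j → ∣ slotColours j ∣ ≡ 2
  ∣slotColours∣≡2 j = ∣pair∣≡2 (λ eq → 0≢1 (cong proj₂ (s-injective eq)))
    where
    0≢1 : 0F ≢ 1F
    0≢1 ()

  ∈slotColours⁻ : ∀ {j x} → x ∈ slotColours j → ∃ λ i → x ≡ s (j , i)
  ∈slotColours⁻ x∈ with x∈pair⁻ x∈
  ... | inj₁ x≡ = 0F , x≡
  ... | inj₂ x≡ = 1F , x≡

  ∉slotColours : ∀ {j} P → proj₁ P ≢ j → s P ∉ slotColours j
  ∉slotColours P P∉j sP∈ with ∈slotColours⁻ sP∈
  ... | i , sP≡ = P∉j (cong proj₁ (s-injective sP≡))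

  slotColours-disjoint : ∀ {j j′} → j ≢ j′ → Empty (slotColours j ∩ slotColours j′)
  slotColours-disjoint j≢j′ (x , x∈) with x∈p∩q⁻ (slotColours _) _ x∈
  ... | x∈j , x∈j′ with ∈slotColours⁻ x∈j | ∈slotColours⁻ x∈j′
  ...   | i , x≡ | i′ , x≡′ = j≢j′ (cong proj₁ (s-injective (trans (sym x≡) x≡′)))

  ∣slotColours∩pair∣≤1 : ∀ j P Q → proj₁ P ≢ proj₁ Q → ∣ slotColours j ∩ pair (s P) (s Q) ∣ ≤ 1
  ∣slotColours∩pair∣≤1 j P Q P≢Q = begin
    ∣ slotColours j ∩ pair (s P) (s Q) ∣ ≡⟨ cong ∣_∣ (∩-comm (slotColours j) _) ⟩
    ∣ pair (s P) (s Q) ∩ slotColours j ∣ ≤⟨ ∣pair∩q∣≤1 _ one-outside ⟩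
    1                                   ∎
    where
    open ≤-Reasoning
    one-outside : s P ∉ slotColours j ⊎ s Q ∉ slotColours j
    one-outside with proj₁ P ≟ j
    ... | yes refl = inj₂ (∉slotColours Q (P≢Q ∘ sym))
    ... | no  P≢j  = inj₁ (∉slotColours P P≢j)

cyclicPred : Fin (suc m) → Fin (suc m)
cyclicPred zero    = fromℕ _
cyclicPred (suc i) = inject₁ i

cyclicPred-injective : Injective _≡_ _≡_ (cyclicPred {m})
cyclicPred-injective {x = zero}  {zero}  _  = refl
cyclicPred-injective {x = zero}  {suc j} eq = contradiction eq fromℕ≢inject₁
cyclicPred-injective {x = suc i} {zero}  eq = contradiction (sym eq) fromℕ≢inject₁
cyclicPred-injective {x = suc i} {suc j} eq = cong suc (inject₁-injective eq)

cyclicPred[i]≢i : ∀ (i : Fin (suc (suc m))) → cyclicPred i ≢ i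
cyclicPred[i]≢i zero    ()
cyclicPred[i]≢i (suc i) eq = 1+n≢n (sym (trans (sym (toℕ-inject₁ i)) (cong toℕ eq)))

transpose-injective : ∀ (i j : Fin n) → Injective _≡_ _≡_ (transpose i j)
transpose-injective i j {x} {y} eq = begin
  x                               ≡⟨ sym (transpose-inverse j i) ⟩
  transpose j i (transpose i j x) ≡⟨ cong (transpose j i) eq ⟩
  transpose j i (transpose i j y) ≡⟨ transpose-inverse j i ⟩
  y                               ∎
  where open ≡-Reasoning

transpose[j]≡i : ∀ (i j : Fin n) → transpose i j j ≡ i
transpose[j]≡i i j with j ≟ i
... | yes refl = refl
... | no  _ rewrite dec-true (j ≟ j) refl = refl

split : Position (suc (suc m)) → Position (suc (suc m))
split (zero  , c)  = zero , c
split (suc i , 0F) = suc i , 0F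
split (suc i , 1F) = suc (cyclicPred i) , 1F

split-injective : Injective _≡_ _≡_ (split {m})
split-injective {x = zero  , c}  {zero  , .c} refl = refl
split-injective {x = suc i , 0F} {suc .i , 0F} refl = refl
split-injective {x = suc i , 1F} {suc j , 1F} eq =
  cong (λ k → suc k , 1F) (cyclicPred-injective (Fin.suc-injective (cong proj₁ eq)))
split-injective {x = zero  , _}  {suc _ , 0F} ()
split-injective {x = zero  , _}  {suc _ , 1F} ()
split-injective {x = suc _ , 0F} {zero  , _}  ()
split-injective {x = suc _ , 1F} {zero  , _}  ()
split-injective {x = suc _ , 0F} {suc _ , 1F} ()
split-injective {x = suc _ , 1F} {suc _ , 0F} ()

reslot : Fin (suc (suc m)) → Position (suc (suc m)) → Position (suc (suc m))
reslot k = map₁ (transpose zero k) ∘ split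

reslot-injective : ∀ (k : Fin (suc (suc m))) → Injective _≡_ _≡_ (reslot k)
reslot-injective k eq = split-injective (cong₂ _,_
  (transpose-injective zero k (cong proj₁ eq)) (cong proj₂ eq))

reslot-straddles : ∀ (k j : Fin (suc (suc (suc m)))) → j ≢ zero →
                   proj₁ (reslot k (j , 0F)) ≢ proj₁ (reslot k (j , 1F))
reslot-straddles k zero    j≢0 _  = j≢0 refl
reslot-straddles k (suc i) _   eq =
  cyclicPred[i]≢i i (sym (Fin.suc-injective (transpose-injective zero k eq)))

module _ {a ℓ} {A : Set a} {R : Rel A ℓ} where

  Linked-lookup : ∀ {x} xs {ys} → Linked R (x ∷ xs ++ ys) → (i : Fin (length xs)) →
                  R (lookup (x ∷ xs) (inject₁ i)) (lookup (x ∷ xs) (suc i))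
  Linked-lookup (y ∷ xs) (r ∷ _)  zero    = r
  Linked-lookup (y ∷ xs) (_ ∷ rs) (suc i) = Linked-lookup xs rs i

  Linked-last : ∀ {x y} xs → Linked R (x ∷ xs ++ [ y ]) → R (lookup (x ∷ xs) (fromℕ (length xs))) y
  Linked-last []         (r ∷ _)  = r
  Linked-last (z ∷ xs)  (_ ∷ rs) = Linked-last xs rs

  Linked-∷ʳ : ∀ {y x z} ms → Linked R (y ∷ ms ++ [ x ]) → R x z →
              Linked R (y ∷ (ms ++ [ x ]) ++ [ z ])
  Linked-∷ʳ []       (yx ∷ _)    xz = yx ∷ xz ∷ [-]
  Linked-∷ʳ (_ ∷ ms) (ym ∷ rest) xz = ym ∷ Linked-∷ʳ ms rest xz

module _ {a} {A : Set a} where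

  Unique-∷ʳ : ∀ {ms : List A} {x} → Unique ms → All (x ≢_) ms → Unique (ms ++ [ x ])
  Unique-∷ʳ unique x∉ms = AllPairs.++⁺ unique ([] ∷ []) (All.map (λ x≢w → (x≢w ∘ sym) ∷ []) x∉ms)

  Unique-lookup-injective : ∀ {xs : List A} → Unique xs → Injective _≡_ _≡_ (lookup xs)
  Unique-lookup-injective {_ ∷ _} _            {zero}  {zero}  _  = refl
  Unique-lookup-injective {_ ∷ _} (x∉xs ∷ _)   {zero}  {suc j} eq =
    contradiction eq (All.lookup x∉xs (∈-lookup j))
  Unique-lookup-injective {_ ∷ _} (x∉xs ∷ _)   {suc i} {zero}  eq =
    contradiction (sym eq) (All.lookup x∉xs (∈-lookup i))
  Unique-lookup-injective {_ ∷ _} (_ ∷ unique) {suc i} {suc j} eq =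
    cong suc (Unique-lookup-injective unique eq)

module Edges {n : ℕ} (G : Graph n) where

  open Decidable⇒UIP Bool._≟_ using (≡-irrelevant)

  Adj : Fin n → Fin n → Set
  Adj u v = adj G u v ≡ true

  Adj-sym : ∀ {u v} → Adj u v → Adj v u
  Adj-sym {u} {v} uv = trans (adj-sym G v u) uv

  Adj⇒≢ : ∀ {u v} → Adj u v → u ≢ v
  Adj⇒≢ {u} uu refl with () ← trans (sym (adj-irrefl G u)) uu

  Joins : Edge G → Fin n → Fin n → Set
  Joins ((a , b) , _) u w = (a ≡ u × b ≡ w) ⊎ (a ≡ w × b ≡ u)

  Joins⇒Adj : ∀ e {u w} → Joins e u w → Adj u w
  Joins⇒Adj (_ , _ , ab) (inj₁ (refl , refl)) = ab
  Joins⇒Adj (_ , _ , ab) (inj₂ (refl , refl)) = Adj-sym ab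

  Joins-ends : ∀ e {u w v x} → Joins e u w → Joins e v x → (v ≡ u × x ≡ w) ⊎ (v ≡ w × x ≡ u)
  Joins-ends _ (inj₁ (refl , refl)) (inj₁ (refl , refl)) = inj₁ (refl , refl)
  Joins-ends _ (inj₁ (refl , refl)) (inj₂ (refl , refl)) = inj₂ (refl , refl)
  Joins-ends _ (inj₂ (refl , refl)) (inj₁ (refl , refl)) = inj₂ (refl , refl)
  Joins-ends _ (inj₂ (refl , refl)) (inj₂ (refl , refl)) = inj₁ (refl , refl)

  Joins-unique : ∀ e e′ {u w} → Joins e u w → Joins e′ u w → e ≡ e′
  Joins-unique (_ , a<b , ab) (_ , a<b′ , ab′) (inj₁ (refl , refl)) (inj₁ (refl , refl)) =
    cong₂ (λ p q → _ , p , q) (<-irrelevant a<b a<b′) (≡-irrelevant ab ab′)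
  Joins-unique (_ , a<b , ab) (_ , a<b′ , ab′) (inj₂ (refl , refl)) (inj₂ (refl , refl)) =
    cong₂ (λ p q → _ , p , q) (<-irrelevant a<b a<b′) (≡-irrelevant ab ab′)
  Joins-unique (_ , a<b , _) (_ , b<a , _) (inj₁ (refl , refl)) (inj₂ (refl , refl)) =
    contradiction b<a (<-asym a<b)
  Joins-unique (_ , b<a , _) (_ , a<b , _) (inj₂ (refl , refl)) (inj₁ (refl , refl)) =
    contradiction b<a (<-asym a<b)

  edgeJoining : ∀ {u w} → Adj u w → Σ (Edge G) λ e → Joins e u w
  edgeJoining {u} {w} uw with <-cmp u w
  ... | tri< u<w _ _ = ((u , w) , u<w , uw) , inj₁ (refl , refl)
  ... | tri≈ _ u≡w _ = contradiction u≡w (Adj⇒≢ uw)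
  ... | tri> _ _ w<u = ((w , u) , w<u , Adj-sym uw) , inj₂ (refl , refl)

  Joins-≢ : ∀ e e′ {u w w′} → Joins e u w → Joins e′ u w′ → e ≢ e′ → w ≢ w′
  Joins-≢ e e′ uw uw′ e≢e′ refl = e≢e′ (Joins-unique e e′ uw uw′)

  LAdj⇒shared : ∀ e e′ → LAdj G e e′ → ∃₂ λ u w → ∃ λ w′ → Joins e u w × Joins e′ u w′ × w ≢ w′
  LAdj⇒shared e@((a , b) , _) e′@((a′ , b′) , _) (e≢e′ , common) = via common
    where
    Shared : Set
    Shared = ∃₂ λ u w → ∃ λ w′ → Joins e u w × Joins e′ u w′ × w ≢ w′
    shares : ∀ {u w w′} → Joins e u w → Joins e′ u w′ → Shared
    shares uw uw′ = _ , _ , _ , uw , uw′ , Joins-≢ e e′ uw uw′ e≢e′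
    via : (a ≡ a′) ⊎ (a ≡ b′) ⊎ (b ≡ a′) ⊎ (b ≡ b′) → Shared
    via (inj₁ refl)               = shares (inj₁ (refl , refl)) (inj₁ (refl , refl))
    via (inj₂ (inj₁ refl))        = shares (inj₁ (refl , refl)) (inj₂ (refl , refl))
    via (inj₂ (inj₂ (inj₁ refl))) = shares (inj₂ (refl , refl)) (inj₁ (refl , refl))
    via (inj₂ (inj₂ (inj₂ refl))) = shares (inj₂ (refl , refl)) (inj₂ (refl , refl))

  shared⇒LAdj : ∀ e e′ {u w w′} → Joins e u w → Joins e′ u w′ → w ≢ w′ → LAdj G e e′
  shared⇒LAdj e e′ uw uw′ w≢w′ = e≢e′ , common {e} {e′} uw uw′
    where
    e≢e′ : e ≢ e′
    e≢e′ refl with Joins-ends e uw uw′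
    ... | inj₁ (_ , w′≡w)  = w≢w′ (sym w′≡w)
    ... | inj₂ (u≡w , _)   = Adj⇒≢ (Joins⇒Adj e uw) u≡w
    common : ∀ {e e′ : Edge G} {u w w′} → Joins e u w → Joins e′ u w′ →
             (endpt₁ {G = G} e ≡ endpt₁ {G = G} e′) ⊎ (endpt₁ {G = G} e ≡ endpt₂ {G = G} e′) ⊎
             (endpt₂ {G = G} e ≡ endpt₁ {G = G} e′) ⊎ (endpt₂ {G = G} e ≡ endpt₂ {G = G} e′)
    common (inj₁ (refl , _)) (inj₁ (refl , _)) = inj₁ refl
    common (inj₁ (refl , _)) (inj₂ (_ , refl)) = inj₂ (inj₁ refl)
    common (inj₂ (_ , refl)) (inj₁ (refl , _)) = inj₂ (inj₂ (inj₁ refl))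
    common (inj₂ (_ , refl)) (inj₂ (_ , refl)) = inj₂ (inj₂ (inj₂ refl))

  closedWalk⇒Cycle : ∀ a₀ a₁ a₂ rest → Linked Adj (a₀ ∷ a₁ ∷ a₂ ∷ rest ++ [ a₀ ]) →
                     Unique (a₀ ∷ a₁ ∷ a₂ ∷ rest) → Cycle G
  closedWalk⇒Cycle a₀ a₁ a₂ rest walk unique = record
    { m     = length rest
    ; c     = lookup (a₀ ∷ a₁ ∷ a₂ ∷ rest)
    ; inj   = Unique-lookup-injective unique
    ; adjs  = Linked-lookup (a₁ ∷ a₂ ∷ rest) walk
    ; close = Linked-last (a₁ ∷ a₂ ∷ rest) walk
    }

leastWitness : ∀ {p} {P : ℕ → Set p} → (∀ k → Dec (P k)) → (∀ {j k} → j ≤ k → P j → P k) →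
               ∀ {k} → P k → Σ ℕ λ d → P d × (∀ {j} → P j → d ≤ j)
leastWitness P? mono {zero}  p = 0 , p , λ _ → z≤n
leastWitness P? mono {suc k} p with P? k
... | yes q  = leastWitness P? mono q
... | no  ¬q = suc k , p , λ pj → ≰⇒> (λ j≤k → ¬q (mono j≤k pj))

record Rooting {n : ℕ} (G : Graph n) : Set where
  field
    root           : Fin n
    parent         : Fin n → Fin n
    depth          : Fin n → ℕ
    parent-adj     : ∀ {v} → v ≢ root → Edges.Adj G v (parent v)
    depth-parent   : ∀ {v} → v ≢ root → depth v ≡ suc (depth (parent v))
    edge-to-parent : ∀ {u w} → Edges.Adj G u w →
                     (w ≢ root × parent w ≡ u) ⊎ (u ≢ root × parent u ≡ w)

module BreadthFirst {n : ℕ} (G : Graph n) (connected : Connected G) (acyclic : Acyclic G)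
                    (r : Fin n) where

  open Edges G

  Within : ℕ → Fin n → Set
  Within zero    v = v ≡ r
  Within (suc k) v = Within k v ⊎ ∃ λ u → Adj v u × Within k u

  within? : ∀ k v → Dec (Within k v)
  within? zero    v = v ≟ r
  within? (suc k) v = within? k v ⊎-dec any? (λ u → (adj G v u Bool.≟ true) ×-dec within? k u)

  Within-mono : ∀ {j k v} → j ≤ k → Within j v → Within k v
  Within-mono {zero}  {zero}  _         v≡r               = v≡r
  Within-mono {zero}  {suc k} _         v≡r               = inj₁ (Within-mono {zero} {k} z≤n v≡r)
  Within-mono {suc j} {suc k} (s≤s j≤k) (inj₁ w)          = inj₁ (Within-mono j≤k w)
  Within-mono {suc j} {suc k} (s≤s j≤k) (inj₂ (u , vu , w)) = inj₂ (u , vu , Within-mono j≤k w)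

  Reach⇒Within : ∀ {v} → Reach G v r → ∃ λ k → Within k v
  Reach⇒Within here             = 0 , refl
  Reach⇒Within (step vu u↝r) with Reach⇒Within u↝r
  ... | k , w = suc k , inj₂ (_ , vu , w)

  depthWitness : ∀ v → Σ ℕ λ d → Within d v × (∀ {k} → Within k v → d ≤ k)
  depthWitness v =
    leastWitness (λ k → within? k v) Within-mono (proj₂ (Reach⇒Within (connected v r)))

  depth : Fin n → ℕ
  depth v = proj₁ (depthWitness v)

  depth-within : ∀ v → Within (depth v) v
  depth-within v = proj₁ (proj₂ (depthWitness v))

  depth-minimal : ∀ {k v} → Within k v → depth v ≤ k
  depth-minimal {v = v} = proj₂ (proj₂ (depthWitness v))

  depth-adj : ∀ {v u} → Adj v u → depth v ≤ suc (depth u)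
  depth-adj {u = u} vu = depth-minimal (inj₂ (u , vu , depth-within u))

  depth≡0⇒root : ∀ {v} → depth v ≡ 0 → v ≡ r
  depth≡0⇒root {v} d≡0 = subst (λ k → Within k v) d≡0 (depth-within v)

  depth≡suc⇒≢root : ∀ {v k} → depth v ≡ suc k → v ≢ r
  depth≡suc⇒≢root d≡ refl with () ← subst (_≤ 0) d≡ (depth-minimal {0} refl)

  stepToward : ∀ k v → Within k v → Fin n
  stepToward zero    v _              = v
  stepToward (suc k) v (inj₁ w)       = stepToward k v w
  stepToward (suc k) v (inj₂ (u , _)) = u

  stepToward-spec : ∀ k v (w : Within k v) → v ≢ r →
                    Adj v (stepToward k v w) × depth (stepToward k v w) < k
  stepToward-spec zero    v v≡r               v≢r = contradiction v≡r v≢r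
  stepToward-spec (suc k) v (inj₁ w)          v≢r = map₂ m<n⇒m<1+n (stepToward-spec k v w v≢r)
  stepToward-spec (suc k) v (inj₂ (u , vu , w)) _ = vu , s≤s (depth-minimal w)

  parent : Fin n → Fin n
  parent v = stepToward (depth v) v (depth-within v)

  parent-adj : ∀ {v} → v ≢ r → Adj v (parent v)
  parent-adj {v} v≢r = proj₁ (stepToward-spec (depth v) v (depth-within v) v≢r)

  depth-parent : ∀ {v} → v ≢ r → depth v ≡ suc (depth (parent v))
  depth-parent {v} v≢r =
    ≤-antisym (depth-adj (parent-adj v≢r)) (proj₂ (stepToward-spec (depth v) v (depth-within v) v≢r))

  <-depth⇒≢ : ∀ {v w} → depth v < depth w → v ≢ w
  <-depth⇒≢ dv<dw refl = <-irrefl refl dv<dw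

  parent-depth : ∀ {v D} → depth v ≡ suc D → depth (parent v) ≡ D
  parent-depth dv = suc-injective (trans (sym (depth-parent (depth≡suc⇒≢root dv))) dv)

  shallower-∉ : ∀ {D v ws} → depth v ≤ D → All (λ w → D < depth w) ws → All (v ≢_) ws
  shallower-∉ dv≤D = All.map (λ D<dw → <-depth⇒≢ (≤-<-trans dv≤D D<dw))

  -- Climbing to the parents of both ends either closes a cycle or gives a detour one
  -- level higher; at depth 0 both ends would be the root.
  noDeepDetour : ∀ D {x y ms} → depth x ≡ D → depth y ≡ D → x ≢ y →
                 Linked Adj (y ∷ ms ++ [ x ]) → Unique ms → All (λ w → D < depth w) ms → ⊥
  noDeepDetour zero    dx dy x≢y _ _ _ = x≢y (trans (depth≡0⇒root dx) (sym (depth≡0⇒root dy)))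
  noDeepDetour (suc D) {x} {y} {ms} dx dy x≢y walk unique deep = climb (parent x ≟ parent y)
    where
    x≢r : x ≢ r
    x≢r = depth≡suc⇒≢root dx
    y≢r : y ≢ r
    y≢r = depth≡suc⇒≢root dy
    x∉ms : All (x ≢_) ms
    x∉ms = shallower-∉ (≤-reflexive dx) deep
    y∉ms : All (y ≢_) ms
    y∉ms = shallower-∉ (≤-reflexive dy) deep

    climb : Dec (parent x ≡ parent y) → ⊥
    climb (yes px≡py) = acyclic (closedWalk⇒Cycle x (parent x) y ms closed distinct)
      where
      px<y : depth (parent x) < depth y
      px<y = subst₂ _<_ (sym (parent-depth dx)) (sym dy) (n<1+n D)
      closed : Linked Adj (x ∷ parent x ∷ y ∷ ms ++ [ x ])
      closed = parent-adj x≢r ∷ subst (λ p → Adj p y) (sym px≡py) (Adj-sym (parent-adj y≢r)) ∷ walk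
      distinct : Unique (x ∷ parent x ∷ y ∷ ms)
      distinct = (Adj⇒≢ (parent-adj x≢r) ∷ x≢y ∷ x∉ms)
               ∷ (<-depth⇒≢ px<y ∷ shallower-∉ (m≤n⇒m≤1+n (≤-reflexive (parent-depth dx))) deep)
               ∷ y∉ms
               ∷ unique
    climb (no px≢py) = noDeepDetour D (parent-depth dx) (parent-depth dy) px≢py
      (Adj-sym (parent-adj y≢r) ∷ Linked-∷ʳ ms walk (parent-adj x≢r))
      (All.++⁺ y∉ms ((x≢y ∘ sym) ∷ []) ∷ Unique-∷ʳ unique x∉ms)
      (≤-reflexive (sym dy) ∷ All.++⁺ (All.map (<-trans (n<1+n D)) deep) (≤-reflexive (sym dx) ∷ []))

  childOf : ∀ {u w} → Adj u w → depth w ≡ suc (depth u) → w ≢ r × parent w ≡ u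
  childOf {u} {w} uw dw with parent w ≟ u
  ... | yes pw≡u = depth≡suc⇒≢root dw , pw≡u
  ... | no  pw≢u = ⊥-elim (noDeepDetour (depth u) refl (parent-depth dw) (pw≢u ∘ sym)
                     (Adj-sym (parent-adj (depth≡suc⇒≢root dw)) ∷ Adj-sym uw ∷ [-])
                     ([] ∷ []) (≤-reflexive (sym dw) ∷ []))

  edge-to-parent : ∀ {u w} → Adj u w → (w ≢ r × parent w ≡ u) ⊎ (u ≢ r × parent u ≡ w)
  edge-to-parent {u} {w} uw with <-cmpℕ (depth u) (depth w)
  ... | tri< du<dw _ _ = inj₁ (childOf uw (≤-antisym (depth-adj (Adj-sym uw)) du<dw))
  ... | tri≈ _ du≡dw _ =
    ⊥-elim (noDeepDetour (depth u) refl (sym du≡dw) (Adj⇒≢ uw) (Adj-sym uw ∷ [-]) [] [])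
  ... | tri> _ _ dw<du = inj₂ (childOf (Adj-sym uw) (≤-antisym (depth-adj uw) dw<du))

  rooting : Rooting G
  rooting = record
    { root           = r
    ; parent         = parent
    ; depth          = depth
    ; parent-adj     = parent-adj
    ; depth-parent   = depth-parent
    ; edge-to-parent = edge-to-parent
    }

module TwoToneColouring {n d : ℕ} (G : Graph n) (R : Rooting G)
                        (degree≤ : ∀ v → degree G v ≤ 3 + d) where

  open Edges G
  open Rooting R

  neighbourIndex : Fin n → Fin n → Fin (3 + d)
  neighbourIndex u w with w ∈? tabulate (adj G u)
  ... | yes w∈N = inject≤ (indexIn _ w∈N) (degree≤ u)
  ... | no  _   = zero

  neighbourIndex-injective : ∀ {u w w′} → Adj u w → Adj u w′ →
                             neighbourIndex u w ≡ neighbourIndex u w′ → w ≡ w′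
  neighbourIndex-injective {u} {w} {w′} uw uw′ eq
    with w ∈? tabulate (adj G u) | w′ ∈? tabulate (adj G u)
  ... | yes w∈N | yes w′∈N = indexIn-injective _ w∈N w′∈N (inject≤-injective _ _ _ _ eq)
  ... | no  w∉N | _        = contradiction (∈-tabulate⁺ uw) w∉N
  ... | yes _   | no  w′∉N = contradiction (∈-tabulate⁺ uw′) w′∉N

  slot : Fin n → Fin n → Fin (3 + d)
  slot u = transpose zero (neighbourIndex u (parent u)) ∘ neighbourIndex u

  slot-parent : ∀ u → slot u (parent u) ≡ zero
  slot-parent u = transpose[j]≡i zero (neighbourIndex u (parent u))

  slot-injective : ∀ {u w w′} → Adj u w → Adj u w′ → slot u w ≡ slot u w′ → w ≡ w′
  slot-injective uw uw′ eq = neighbourIndex-injective uw uw′ (transpose-injective zero _ eq)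

  rootPalette : Position (3 + d) → Fin (2 * (3 + d))
  rootPalette (j , c) = combine c j

  rootPalette-injective : Injective _≡_ _≡_ rootPalette
  rootPalette-injective {j , c} {j′ , c′} eq with combine-injective c j c′ j′ eq
  ... | refl , refl = refl

  -- Recursion on the depth, since parent v is not structurally smaller than v.
  paletteAtDepth : ℕ → Fin n → Position (3 + d) → Fin (2 * (3 + d))
  paletteAtDepth zero    v = rootPalette
  paletteAtDepth (suc k) v = paletteAtDepth k (parent v) ∘ reslot (slot (parent v) v)

  paletteAtDepth-injective : ∀ k v → Injective _≡_ _≡_ (paletteAtDepth k v)
  paletteAtDepth-injective zero    v eq = rootPalette-injective eq
  paletteAtDepth-injective (suc k) v eq =
    reslot-injective (slot (parent v) v) (paletteAtDepth-injective k (parent v) eq)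

  palette : Fin n → Position (3 + d) → Fin (2 * (3 + d))
  palette v = paletteAtDepth (depth v) v

  palette-injective : ∀ v → Injective _≡_ _≡_ (palette v)
  palette-injective v = paletteAtDepth-injective (depth v) v

  palette-parent : ∀ {v} → v ≢ root → ∀ p →
                   palette v p ≡ palette (parent v) (reslot (slot (parent v) v) p)
  palette-parent {v} v≢r p rewrite depth-parent v≢r = refl

  edgeColours : Fin n → Fin n → Subset (2 * (3 + d))
  edgeColours u w = slotColours (palette-injective u) (slot u w)

  edgeColours-toParent : ∀ {v} → v ≢ root → edgeColours v (parent v) ≡ edgeColours (parent v) v
  edgeColours-toParent {v} v≢r rewrite slot-parent v =
    cong₂ pair (palette-parent v≢r (zero , 0F)) (palette-parent v≢r (zero , 1F))

  edgeColours-sym : ∀ {u w} → Adj u w → edgeColours u w ≡ edgeColours w u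
  edgeColours-sym uw with edge-to-parent uw
  ... | inj₁ (w≢r , refl) = sym (edgeColours-toParent w≢r)
  ... | inj₂ (u≢r , refl) = edgeColours-toParent u≢r

  edgeColours-disjoint : ∀ {u w w′} → Adj u w → Adj u w′ → w ≢ w′ →
                         Empty (edgeColours u w ∩ edgeColours u w′)
  edgeColours-disjoint uw uw′ w≢w′ =
    slotColours-disjoint (palette-injective _) (w≢w′ ∘ slot-injective uw uw′)

  childEdge-straddles : ∀ {v x} → v ≢ root → Adj v x → x ≢ parent v → ∀ j →
                        ∣ slotColours (palette-injective (parent v)) j ∩ edgeColours v x ∣ ≤ 1
  childEdge-straddles {v} {x} v≢r vx x≢pv j =
    subst (λ S → ∣ slotColours (palette-injective (parent v)) j ∩ S ∣ ≤ 1)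
          (sym (cong₂ pair (palette-parent v≢r _) (palette-parent v≢r _)))
          (∣slotColours∩pair∣≤1 (palette-injective (parent v)) j _ _
            (reslot-straddles (slot (parent v) v) (slot v x) slot≢0))
    where
    slot≢0 : slot v x ≢ zero
    slot≢0 eq = x≢pv (slot-injective vx (parent-adj v≢r) (trans eq (sym (slot-parent v))))

  edgeColours-path : ∀ {u w w′ x} → Adj u w → Adj u w′ → Adj w′ x → w ≢ w′ → x ≢ u →
                     ∣ edgeColours u w ∩ edgeColours w′ x ∣ ≤ 1
  edgeColours-path {u} {w} {w′} {x} uw uw′ w′x w≢w′ x≢u with edge-to-parent uw′
  ... | inj₁ (w′≢r , refl) = childEdge-straddles w′≢r w′x x≢u (slot u w)
  ... | inj₂ (u≢r , refl)  = begin
    ∣ edgeColours u w ∩ edgeColours (parent u) x ∣ ≡⟨ cong ∣_∣ (∩-comm (edgeColours u w) _) ⟩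
    ∣ edgeColours (parent u) x ∩ edgeColours u w ∣ ≤⟨ childEdge-straddles u≢r uw w≢w′ (slot (parent u) x) ⟩
    1                                             ∎
    where open ≤-Reasoning

  label : Edge G → Subset (2 * (3 + d))
  label ((a , b) , _) = edgeColours a b

  ∣label∣≡2 : ∀ e → ∣ label e ∣ ≡ 2
  ∣label∣≡2 ((a , b) , _) = ∣slotColours∣≡2 (palette-injective a) (slot a b)

  label-joins : ∀ e {u w} → Joins e u w → label e ≡ edgeColours u w
  label-joins _            (inj₁ (refl , refl)) = refl
  label-joins (_ , _ , ab) (inj₂ (refl , refl)) = edgeColours-sym ab

  overlap-adjacent : ∀ {e e′} → LAdj G e e′ → ∣ label e ∩ label e′ ∣ ≡ 0
  overlap-adjacent {e} {e′} ee′ with LAdj⇒shared e e′ ee′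
  ... | _ , _ , _ , uw , uw′ , w≢w′ rewrite label-joins e uw | label-joins e′ uw′ =
    Empty⇒∣p∣≡0 (edgeColours-disjoint (Joins⇒Adj e uw) (Joins⇒Adj e′ uw′) w≢w′)

  overlap-distance2 : ∀ {e f e′} → e ≢ e′ → LAdj G e f → LAdj G f e′ → ∣ label e ∩ label e′ ∣ ≤ 1
  overlap-distance2 {e} {f} {e′} e≢e′ ef fe′
    with LAdj⇒shared e f ef | LAdj⇒shared f e′ fe′
  ... | u , w , w′ , uw , uw′ , w≢w′ | v , x , x′ , vx , vx′ , x≢x′ with Joins-ends f uw′ vx
  -- Either e′ also meets f at u, so e and e′ are adjacent, or e, f, e′ form a path w u w′ x′.
  ...   | inj₁ (refl , refl) =
    subst (_≤ 1) (sym (overlap-adjacent (shared⇒LAdj e e′ uw vx′ (Joins-≢ e e′ uw vx′ e≢e′)))) z≤n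
  ...   | inj₂ (refl , refl) rewrite label-joins e uw | label-joins e′ vx′ =
    edgeColours-path (Joins⇒Adj e uw) (Joins⇒Adj f uw′) (Joins⇒Adj e′ vx′) w≢w′ (x≢x′ ∘ sym)

  overlap<distance : ∀ {e e′ k} → e ≢ e′ → LWalk G e e′ (suc k) → ∣ label e ∩ label e′ ∣ ≤ k
  overlap<distance e≢e′ (step ee′ here)            = ≤-reflexive (overlap-adjacent ee′)
  overlap<distance e≢e′ (step ef (step fe′ here))  = overlap-distance2 e≢e′ ef fe′
  overlap<distance {e} {e′} e≢e′ (step _ (step _ (step {k = k} _ _))) = begin
    ∣ label e ∩ label e′ ∣ ≤⟨ ∣p∩q∣≤∣p∣ (label e) (label e′) ⟩
    ∣ label e ∣            ≡⟨ ∣label∣≡2 e ⟩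
    2                      ≤⟨ s≤s (s≤s z≤n) ⟩
    2 + k                  ∎
    where open ≤-Reasoning

  colouring : ToneEdgeColoring 2 (2 * (3 + d)) G
  colouring = label , ∣label∣≡2 , valid
    where
    valid : ∀ e e′ → e ≢ e′ → ¬ DistLE G e e′ ∣ label e ∩ label e′ ∣
    valid e e′ e≢e′ (zero  , _    , here) = e≢e′ refl
    valid e e′ e≢e′ (suc k , k<∩ , walk) = <⇒≱ k<∩ (overlap<distance e≢e′ walk)

twoToneColouring : ∀ {n D} (G : Graph n) → Rooting G → 3 ≤ D → (∀ v → degree G v ≤ D) →
                   ToneEdgeColoring 2 (2 * D) G
twoToneColouring G R (s≤s (s≤s (s≤s _))) degree≤ = TwoToneColouring.colouring G R degree≤

2*degree≤colours : ∀ {n k} (G : Graph n) v → ToneEdgeColoring 2 k G → 2 * degree G v ≤ k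
2*degree≤colours G v (f , size , valid) = c*∣S∣≤m (tabulate (adj G v)) F (λ _ _ → size _) disjoint
  where
  open Edges G
  edgeTo : ∀ x → x ∈ tabulate (adj G v) → Σ (Edge G) λ e → Joins e v x
  edgeTo x x∈N = edgeJoining (∈-tabulate⁻ x∈N)
  F : ∀ x → x ∈ tabulate (adj G v) → Subset _
  F x x∈N = f (proj₁ (edgeTo x x∈N))
  disjoint : ∀ x y x∈N y∈N → x ≢ y → Empty (F x x∈N ∩ F y y∈N)
  disjoint x y x∈N y∈N x≢y (_ , c∈) = valid _ _ (proj₁ ee′) (1 , x∈p⇒0<∣p∣ c∈ , step ee′ here)
    where
    ee′ : LAdj G (proj₁ (edgeTo x x∈N)) (proj₁ (edgeTo y y∈N))
    ee′ = shared⇒LAdj _ _ (proj₂ (edgeTo x x∈N)) (proj₂ (edgeTo y y∈N)) x≢y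

≤-foldr-⊔ : ∀ {A : Set} (g : A → ℕ) {x} xs → x ∈ₗ xs → g x ≤ foldr _⊔_ 0 (map g xs)
≤-foldr-⊔ g (y ∷ xs) (here refl) = m≤m⊔n (g y) _
≤-foldr-⊔ g (y ∷ xs) (there x∈xs) = ≤-trans (≤-foldr-⊔ g xs x∈xs) (m≤n⊔m (g y) _)

foldr-⊔-attained : ∀ {A : Set} (g : A → ℕ) xs → 0 < foldr _⊔_ 0 (map g xs) →
                   ∃ λ x → g x ≡ foldr _⊔_ 0 (map g xs)
foldr-⊔-attained g (y ∷ xs) 0<max with ⊔-sel (g y) (foldr _⊔_ 0 (map g xs))
... | inj₁ max≡gy = y , sym max≡gy
... | inj₂ max≡rest with foldr-⊔-attained g xs (subst (0 <_) max≡rest 0<max)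
...   | x , gx≡ = x , trans gx≡ (sym max≡rest)

degree≤maxDegree : ∀ {n} (G : Graph n) v → degree G v ≤ maxDegree G
degree≤maxDegree {n} G v = ≤-foldr-⊔ (degree G) (allFin n) (∈-allFin v)

maxDegree-attained : ∀ {n} (G : Graph n) → 0 < maxDegree G → ∃ λ v → degree G v ≡ maxDegree G
maxDegree-attained {n} G = foldr-⊔-attained (degree G) (allFin n)

mainTheorem1 : ∀ (n : ℕ) (T : Graph n) → IsTree T → 3 ≤ maxDegree T →
    ToneChromaticIndexIs 2 T (2 * maxDegree T)
mainTheorem1 n T (connected , acyclic) 3≤Δ with maxDegree-attained T (≤-trans (s≤s z≤n) 3≤Δ)
... | v , dv≡Δ = upper , lower
  where
  upper : ToneEdgeColoring 2 (2 * maxDegree T) T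
  upper = twoToneColouring T (BreadthFirst.rooting T connected acyclic v) 3≤Δ (degree≤maxDegree T)
  lower : ∀ j → j < 2 * maxDegree T → ¬ ToneEdgeColoring 2 j T
  lower j j<2Δ colouring = <⇒≱ j<2Δ (subst (λ δ → 2 * δ ≤ j) dv≡Δ (2*degree≤colours T v colouring))
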